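{- Assume $\mathbb T$ is propositionally stable. If $A$ is a stably quasi-coherent $\mathbb I$-algebra, then \[ LA\cong\sum_{i:\mathbb I}A/i, \] where $A/i$ denotes the quotient algebra $A/(i=1)$.
   Context: We work in intensional type theory with function extensionality. $\mathbb I$ is a model of a Horn theory $\mathbb T$; an $\mathbb I$-algebra is a $\mathbb T$-model $A$ with a homomorphism $\mathbb I\to A$ (elements of $\mathbb I$ identified with their images in $A$). $\operatorname{Spec}A:=\mathbb I\text{ - }\mathbf{Alg}(A,\mathbb I)$; $\mathcal O X:=\mathbb I^X$. $A$ is quasi-coherent if $\iota_A:A\to\mathcal O\operatorname{Spec}A$, $a\mapsto(x\mapsto x(a))$, is an isomorphism; stably quasi-coherent if every quotient $A/(a=b)$ ($n:\mathbb N$, $a,b:n\to A$) is quasi-coherent. $\mathbb T$ is propositionally stable if it extends bounded meet-semilattices and for each model $A$ and $a:A$ the quotient $A/(a=1)$ is $a\wedge-:A\to{\downarrow}a$. The partial map classifier is $LX:=\sum_{i:\mathbb I}X^{(i=1)}$ for a type $X$. -}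

module Defs where

open import Level using (0ℓ)
open import Data.Nat using (ℕ)
open import Data.Fin using (Fin; zero; suc)
open import Data.Product using (Σ; _×_; _,_; proj₁; proj₂)
open import Relation.Binary.PropositionalEquality using (_≡_)
open import Axiom.UniquenessOfIdentityProofs using (UIP)
open import Function.Bundles using (_↔_; Inverse)

record Signature : Set₁ where
  field Sym : ℕ → Set
open Signature public

data Term (S : Signature) (m : ℕ) : Set where
  var : Fin m → Term S m
  app : ∀ {k} → Sym S k → (Fin k → Term S m) → Term S m

record Horn (S : Signature) : Set where
  field
    vars  : ℕ
    nprem : ℕ
    prem  : Fin nprem → Term S vars × Term S vars
    concl : Term S vars × Term S vars
open Horn public

record HornTheory : Set₁ where
  field
    sig   : Signature
    Ax    : Set
    axiom : Ax → Horn sig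
open HornTheory public

module _ (T : HornTheory) where

  record Structure : Set₁ where
    field
      Carrier : Set
      op      : ∀ {k} → Sym (sig T) k → (Fin k → Carrier) → Carrier
  open Structure public

  eval : (M : Structure) {m : ℕ} → Term (sig T) m → (Fin m → Carrier M) → Carrier M
  eval M (var x)    ρ = ρ x
  eval M (app f ts) ρ = op M f (λ j → eval M (ts j) ρ)

  Satisfies : Structure → Horn (sig T) → Set
  Satisfies M h =
    (ρ : Fin (vars h) → Carrier M) →
    ((j : Fin (nprem h)) → eval M (proj₁ (prem h j)) ρ ≡ eval M (proj₂ (prem h j)) ρ) →
    eval M (proj₁ (concl h)) ρ ≡ eval M (proj₂ (concl h)) ρ

  record Model : Set₁ where
    field
      str   : Structure
      isSet : UIP (Carrier str)
      sat   : (ax : Ax T) → Satisfies str (axiom T ax)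
  open Model public

  ∣_∣ : Model → Set
  ∣ M ∣ = Carrier (str M)

  opM : (M : Model) {k : ℕ} → Sym (sig T) k → (Fin k → ∣ M ∣) → ∣ M ∣
  opM M = op (str M)

  IsHom : (M N : Model) → (∣ M ∣ → ∣ N ∣) → Set
  IsHom M N f = ∀ {k} (s : Sym (sig T) k) (xs : Fin k → ∣ M ∣) →
                f (opM M s xs) ≡ opM N s (λ j → f (xs j))

  record IsQuotient (A : Model) {n : ℕ} (a b : Fin n → ∣ A ∣)
                    (B : Model) (q : ∣ A ∣ → ∣ B ∣) : Set₁ where
    field
      hom   : IsHom A B q
      coeq  : (j : Fin n) → q (a j) ≡ q (b j)
      univ  : (C : Model) (h : ∣ A ∣ → ∣ C ∣) → IsHom A C h →
              ((j : Fin n) → h (a j) ≡ h (b j)) →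
              Σ (∣ B ∣ → ∣ C ∣) λ u → IsHom B C u × ((x : ∣ A ∣) → u (q x) ≡ h x)
      uniq  : (C : Model) (u v : ∣ B ∣ → ∣ C ∣) → IsHom B C u → IsHom B C v →
              ((x : ∣ A ∣) → u (q x) ≡ v (q x)) → (y : ∣ B ∣) → u y ≡ v y

  pair : {X : Set} → X → X → Fin 2 → X
  pair x y zero    = x
  pair x y (suc _) = y

  noArgs : {X : Set} → Fin 0 → X
  noArgs ()

record BSLSymbols (T : HornTheory) : Set where
  field
    meet : Sym (sig T) 2
    top  : Sym (sig T) 0
    bot  : Sym (sig T) 0
open BSLSymbols public

module _ {T : HornTheory} (σ : BSLSymbols T) (M : Model T) where
  _∧_ : ∣ T ∣ M → ∣ T ∣ M → ∣ T ∣ M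
  x ∧ y = opM T M (meet σ) (pair T x y)

  𝟙 : ∣ T ∣ M
  𝟙 = opM T M (top σ) (noArgs T)

  𝟘 : ∣ T ∣ M
  𝟘 = opM T M (bot σ) (noArgs T)

  -- ↓a = { x | x ≤ a },  x ≤ a :≡ (a ∧ x = x)
  ↓ : ∣ T ∣ M → Set
  ↓ a = Σ (∣ T ∣ M) λ x → a ∧ x ≡ x

record PropStable (T : HornTheory) : Set₁ where
  field
    syms : BSLSymbols T
    ∧-assoc : (M : Model T) (x y z : ∣ T ∣ M) →
              _∧_ syms M (_∧_ syms M x y) z ≡ _∧_ syms M x (_∧_ syms M y z)
    ∧-comm  : (M : Model T) (x y : ∣ T ∣ M) → _∧_ syms M x y ≡ _∧_ syms M y x
    ∧-idem  : (M : Model T) (x : ∣ T ∣ M) → _∧_ syms M x x ≡ x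
    ∧-top   : (M : Model T) (x : ∣ T ∣ M) → _∧_ syms M x (𝟙 syms M) ≡ x
    ∧-bot   : (M : Model T) (x : ∣ T ∣ M) → _∧_ syms M x (𝟘 syms M) ≡ 𝟘 syms M
    -- the quotient A/(a = 1) is  a ∧ - : A → ↓a
    stable  : (M : Model T) (a : ∣ T ∣ M) →
              Σ (Model T) λ D → Σ (∣ T ∣ M → ∣ T ∣ D) λ q →
                IsQuotient T M {1} (λ _ → a) (λ _ → 𝟙 syms M) D q ×
                Σ (∣ T ∣ D ↔ ↓ syms M a) λ e →
                  (x : ∣ T ∣ M) → proj₁ (Inverse.to e (q x)) ≡ _∧_ syms M a x
open PropStable public

module _ (T : HornTheory) (I : Model T) where

  record IAlg : Set₁ where
    field
      alg  : Model T
      η    : ∣ T ∣ I → ∣ T ∣ alg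
      ηhom : IsHom T I alg η
  open IAlg public

  Spec′ : (B : Model T) → (∣ T ∣ I → ∣ T ∣ B) → Set
  Spec′ B ηB = Σ (∣ T ∣ B → ∣ T ∣ I) λ f →
                 IsHom T B I f × ((i : ∣ T ∣ I) → f (ηB i) ≡ i)

  ι′ : (B : Model T) (ηB : ∣ T ∣ I → ∣ T ∣ B) → ∣ T ∣ B → (Spec′ B ηB → ∣ T ∣ I)
  ι′ B ηB a x = proj₁ x a

  IsIso : {X Y : Set} → (X → Y) → Set
  IsIso {X} {Y} f = Σ (Y → X) λ g → ((x : X) → g (f x) ≡ x) × ((y : Y) → f (g y) ≡ y)

  QC′ : (B : Model T) → (∣ T ∣ I → ∣ T ∣ B) → Set
  QC′ B ηB = IsIso (ι′ B ηB)

  Spec : IAlg → Set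
  Spec A = Spec′ (alg A) (η A)

  QuasiCoherent : IAlg → Set
  QuasiCoherent A = QC′ (alg A) (η A)

  StablyQC : IAlg → Set₁
  StablyQC A = (n : ℕ) (a b : Fin n → ∣ T ∣ (alg A)) (B : Model T) (q : ∣ T ∣ (alg A) → ∣ T ∣ B) →
               IsQuotient T (alg A) a b B q → QC′ B (λ i → q (η A i))

  L : PropStable T → Set → Set
  L PS X = Σ (∣ T ∣ I) λ i → (i ≡ 𝟙 (syms PS) I → X)

-- A point of Spec (A/i) sends
-- i = η i to 1, so Spec (A/i) lies over the proposition i = 1; by
-- quasi-coherence of A/i, an element of A/i is then the same as a function
-- (i = 1 → A/i). Under i = 1 the quotient map A → A/i is invertible, so that
-- function space is (i = 1 → A).
module Submission where

open import Defs
open import Level using (0ℓ)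
open import Data.Nat using (ℕ)
open import Data.Fin using (Fin; zero)
open import Data.Product using (Σ; _,_; proj₁)
open import Data.Product.Function.Dependent.Propositional using (congˡ)
open import Function.Bundles using (_↔_; mk↔ₛ′; Inverse)
open import Function.Properties.Inverse using (↔-trans)
open import Function.Related.Propositional using (bijection)
open import Axiom.Extensionality.Propositional using (Extensionality)
open import Relation.Binary.PropositionalEquality

Π-cong-↔ : Extensionality 0ℓ 0ℓ → {P X Y : Set} → (P → X ↔ Y) → (P → X) ↔ (P → Y)
Π-cong-↔ ext X↔Y = mk↔ₛ′
  (λ h p → Inverse.to (X↔Y p) (h p))
  (λ k p → Inverse.from (X↔Y p) (k p))
  (λ k → ext λ p → Inverse.strictlyInverseˡ (X↔Y p) (k p))
  (λ h → ext λ p → Inverse.strictlyInverseʳ (X↔Y p) (h p))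

module _ {T : HornTheory} where

  IsHom-id : (M : Model T) → IsHom T M M (λ x → x)
  IsHom-id M s xs = refl

  IsHom-∘ : {M N K : Model T} (f : ∣ T ∣ M → ∣ T ∣ N) (g : ∣ T ∣ N → ∣ T ∣ K) →
            IsHom T M N f → IsHom T N K g → IsHom T M K (λ x → g (f x))
  IsHom-∘ f g f-hom g-hom s xs = trans (cong g (f-hom s xs)) (g-hom s (λ j → f (xs j)))

  IsHom-𝟙 : Extensionality 0ℓ 0ℓ → (σ : BSLSymbols T) {M N : Model T} (f : ∣ T ∣ M → ∣ T ∣ N) →
            IsHom T M N f → f (𝟙 σ M) ≡ 𝟙 σ N
  IsHom-𝟙 ext σ {N = N} f f-hom =
    trans (f-hom (top σ) (noArgs T)) (cong (opM T N (top σ)) (ext λ ()))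

  IsQuotient-trivial-↔ : {A B : Model T} {n : ℕ} {a b : Fin n → ∣ T ∣ A} {q : ∣ T ∣ A → ∣ T ∣ B} →
                         IsQuotient T A a b B q → ((j : Fin n) → a j ≡ b j) → ∣ T ∣ A ↔ ∣ T ∣ B
  IsQuotient-trivial-↔ {A} {B} {q = q} quot a≡b with IsQuotient.univ quot A (λ x → x) (IsHom-id A) a≡b
  ... | u , u-hom , u∘q≗id = mk↔ₛ′ q u q∘u≗id u∘q≗id
    where
    q∘u≗id : (z : ∣ T ∣ B) → q (u z) ≡ z
    q∘u≗id = IsQuotient.uniq quot B (λ z → q (u z)) (λ z → z)
               (IsHom-∘ {B} {A} {B} u q u-hom (IsQuotient.hom quot)) (IsHom-id B)
               (λ x → cong q (u∘q≗id x))

  module _ (I : Model T) where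

    QC-over-prop-↔ : Extensionality 0ℓ 0ℓ → (B : Model T) (ηB : ∣ T ∣ I → ∣ T ∣ B) {P : Set} →
                     ((p p′ : P) → p ≡ p′) → (over : Spec′ T I B ηB → P) → QC′ T I B ηB →
                     (P → ∣ T ∣ B) ↔ ∣ T ∣ B
    QC-over-prop-↔ ext B ηB P-prop over (ι⁻¹ , ι⁻¹∘ι≗id , _) = mk↔ₛ′
      (λ b → ι⁻¹ (λ y → proj₁ y (b (over y))))
      (λ b _ → b)
      ι⁻¹∘ι≗id
      (λ b → ext λ p → begin
        ι⁻¹ (λ y → proj₁ y (b (over y))) ≡⟨ cong ι⁻¹ (ext λ y →
                                               cong (λ p′ → proj₁ y (b p′)) (P-prop (over y) p)) ⟩
        ι⁻¹ (ι′ T I B ηB (b p))           ≡⟨ ι⁻¹∘ι≗id (b p) ⟩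
        b p                               ∎)
      where open ≡-Reasoning

    module _ (ext : Extensionality 0ℓ 0ℓ) (σ : BSLSymbols T) (A : IAlg T I) {i : ∣ T ∣ I}
             {B : Model T} {q : ∣ T ∣ (alg A) → ∣ T ∣ B}
             (quot : IsQuotient T (alg A) {1} (λ _ → η A i) (λ _ → 𝟙 σ (alg A)) B q) where

      Spec-quotient⇒≡𝟙 : Spec′ T I B (λ j → q (η A j)) → i ≡ 𝟙 σ I
      Spec-quotient⇒≡𝟙 (f , f-hom , f∘q∘η≗id) = begin
        i                     ≡⟨ sym (f∘q∘η≗id i) ⟩
        f (q (η A i))         ≡⟨ cong f (IsQuotient.coeq quot zero) ⟩
        f (q (𝟙 σ (alg A)))   ≡⟨ IsHom-𝟙 ext σ {alg A} {I} (λ x → f (q x))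
                                    (IsHom-∘ {alg A} {B} {I} q f (IsQuotient.hom quot) f-hom) ⟩
        𝟙 σ I                 ∎
        where open ≡-Reasoning

      partial-↔-quotient : QC′ T I B (λ j → q (η A j)) → (i ≡ 𝟙 σ I → ∣ T ∣ (alg A)) ↔ ∣ T ∣ B
      partial-↔-quotient qc = ↔-trans
        (Π-cong-↔ ext λ i≡𝟙 → IsQuotient-trivial-↔ quot λ _ →
          trans (cong (η A) i≡𝟙) (IsHom-𝟙 ext σ {I} {alg A} (η A) (ηhom A)))
        (QC-over-prop-↔ ext B (λ j → q (η A j)) (isSet I) Spec-quotient⇒≡𝟙 qc)

proposition4p2 : Extensionality 0ℓ 0ℓ →
    (T : HornTheory) (PS : PropStable T) (I : Model T) (A : IAlg T I) →
    StablyQC T I A →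
    (Q : ∣ T ∣ I → Model T) (q : (i : ∣ T ∣ I) → ∣ T ∣ (alg A) → ∣ T ∣ (Q i)) →
    ((i : ∣ T ∣ I) → IsQuotient T (alg A) {1} (λ _ → η A i) (λ _ → 𝟙 (syms PS) (alg A)) (Q i) (q i)) →
    L T I PS (∣ T ∣ (alg A)) ↔ Σ (∣ T ∣ I) (λ i → ∣ T ∣ (Q i))
proposition4p2 ext T PS I A sqc Q q quot = congˡ {k = bijection} λ {i} →
  partial-↔-quotient I ext (syms PS) A (quot i) (sqc 1 _ _ (Q i) (q i) (quot i))
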